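{- The categories $\mathbf{Grphs}$ and $\mathbf{StGrphs}$ are balanced: in each of them, any morphism that is both an epimorphism and a monomorphism is an isomorphism.
   Context: A graph $G$ consists of a vertex set $V(G)$, an edge set $E(G)$ disjoint from it, and an incidence function $\psi_G$ assigning to each edge an unordered pair $\{x,y\}$ of (not necessarily distinct) vertices; multiple edges and loops are allowed. The part set of $G$ is $P(G)=E(G)\cup V(G)$, and for a vertex $v$ we set $\psi_G(v)=\{v,v\}$. A graph morphism $f:G\to H$ is a function $f:P(G)\to P(H)$ with $f(V(G))\subseteq V(H)$ that preserves incidence: $\psi_H(f(e))=\{f(x),f(y)\}$ whenever $\psi_G(e)=\{x,y\}$, for all $e\in P(G)$. A strict graph morphism is a graph morphism sending edges to edges. $\mathbf{Grphs}$ is the category of all graphs with graph morphisms; $\mathbf{StGrphs}$ is the category of all graphs with strict graph morphisms. -}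

module Defs where

open import Level using (0ℓ)
open import Data.Unit using (⊤)
open import Data.Empty using (⊥)
open import Data.Product using (Σ; _×_; _,_; proj₁; proj₂)
open import Data.Sum using (_⊎_; inj₁; inj₂)
open import Data.Sum.Relation.Binary.Pointwise using (Pointwise)
open import Relation.Binary.Bundles using (Setoid)

-- Graphs are modelled with Bishop sets (setoids), the standard constructive
-- rendering of "set" in Agda (no quotients are available).

-- Equality of unordered pairs {a,b} = {c,d}, for pairs represented as
-- ordered pairs, relative to an equivalence relation _≈_.
UEq : {A : Set} → (A → A → Set) → A × A → A × A → Set
UEq _≈_ (a , b) (c , d) = ((a ≈ c) × (b ≈ d)) ⊎ ((a ≈ d) × (b ≈ c))

record Graph : Set₁ where
  field
    V : Setoid 0ℓ 0ℓ
    E : Setoid 0ℓ 0ℓ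
  module V = Setoid V
  module E = Setoid E
  field
    ψ      : E.Carrier → V.Carrier × V.Carrier
    ψ-cong : ∀ {e e′} → e E.≈ e′ → UEq V._≈_ (ψ e) (ψ e′)

  Part : Set
  Part = V.Carrier ⊎ E.Carrier

  _≈P_ : Part → Part → Set
  _≈P_ = Pointwise V._≈_ E._≈_

  ψP : Part → Part × Part
  ψP (inj₁ v) = inj₁ v , inj₁ v
  ψP (inj₂ e) = inj₁ (proj₁ (ψ e)) , inj₁ (proj₂ (ψ e))

open Graph public

IsVertex : {A B : Set} → A ⊎ B → Set
IsVertex (inj₁ _) = ⊤
IsVertex (inj₂ _) = ⊥

IsEdge : {A B : Set} → A ⊎ B → Set
IsEdge (inj₁ _) = ⊥
IsEdge (inj₂ _) = ⊤

record Hom (G H : Graph) : Set where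
  field
    fun    : Part G → Part H
    cong   : ∀ {p q} → _≈P_ G p q → _≈P_ H (fun p) (fun q)
    vert   : ∀ v → IsVertex (fun (inj₁ v))
    incid  : ∀ p → UEq (_≈P_ H) (ψP H (fun p))
                       (fun (proj₁ (ψP G p)) , fun (proj₂ (ψP G p)))

open Hom public

IsStrict : {G H : Graph} → Hom G H → Set
IsStrict {G} f = ∀ e → IsEdge (fun f (inj₂ e))

_≈H_ : {G H : Graph} → Hom G H → Hom G H → Set
_≈H_ {G} {H} f g = ∀ p → _≈P_ H (fun f p) (fun g p)

-- A category of graphs is determined by a class of admissible morphisms:
-- all morphisms (Grphs) or the strict ones (StGrphs).
MorClass : Set₁
MorClass = {G H : Graph} → Hom G H → Set

AllMor : MorClass
AllMor _ = ⊤

StrictMor : MorClass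
StrictMor = IsStrict

idH : (G : Graph) → Hom G G
idH G = record
  { fun = λ p → p
  ; cong = λ e → e
  ; vert = λ v → _
  ; incid = λ p → inj₁ (Setoid.refl (⊎-s G) , Setoid.refl (⊎-s G))
  }
  where
  open import Data.Sum.Relation.Binary.Pointwise using (⊎-setoid)
  ⊎-s : (G : Graph) → Setoid 0ℓ 0ℓ
  ⊎-s G = ⊎-setoid (V G) (E G)

_∘H_ : {G H K : Graph} → Hom H K → Hom G H → Hom G K
_∘H_ {G} {H} {K} g f = record
  { fun = λ p → fun g (fun f p)
  ; cong = λ e → cong g (cong f e)
  ; vert = λ v → vertLem (fun f (inj₁ v)) (vert f v)
  ; incid = λ p → ueqTrans (incLem (fun f p)) (ueqMap (incid f p))
  }
  where
  open import Data.Sum.Relation.Binary.Pointwise using (⊎-setoid)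
  S : Setoid 0ℓ 0ℓ
  S = ⊎-setoid (V K) (E K)
  module S = Setoid S
  vertLem : (q : Part H) → IsVertex q → IsVertex (fun g q)
  vertLem (inj₁ w) _ = vert g w
  incLem : (q : Part H) → UEq (_≈P_ K) (ψP K (fun g q))
                             (fun g (proj₁ (ψP H q)) , fun g (proj₂ (ψP H q)))
  incLem q = incid g q
  ueqMap : ∀ {a b c d} → UEq (_≈P_ H) (a , b) (c , d)
           → UEq (_≈P_ K) (fun g a , fun g b) (fun g c , fun g d)
  ueqMap (inj₁ (x , y)) = inj₁ (cong g x , cong g y)
  ueqMap (inj₂ (x , y)) = inj₂ (cong g x , cong g y)
  ueqTrans : ∀ {a b c d e f} → UEq S._≈_ (a , b) (c , d) → UEq S._≈_ (c , d) (e , f)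
             → UEq S._≈_ (a , b) (e , f)
  ueqTrans (inj₁ (x , y)) (inj₁ (z , w)) = inj₁ (S.trans x z , S.trans y w)
  ueqTrans (inj₁ (x , y)) (inj₂ (z , w)) = inj₂ (S.trans x z , S.trans y w)
  ueqTrans (inj₂ (x , y)) (inj₁ (z , w)) = inj₂ (S.trans x w , S.trans y z)
  ueqTrans (inj₂ (x , y)) (inj₂ (z , w)) = inj₁ (S.trans x w , S.trans y z)

Mono : MorClass → {G H : Graph} → Hom G H → Set₁
Mono C {G} {H} f = ∀ (K : Graph) (g h : Hom K G) → C g → C h
                   → (f ∘H g) ≈H (f ∘H h) → g ≈H h

Epi : MorClass → {G H : Graph} → Hom G H → Set₁
Epi C {G} {H} f = ∀ (K : Graph) (g h : Hom H K) → C g → C h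
                  → (g ∘H f) ≈H (h ∘H f) → g ≈H h

Iso : MorClass → {G H : Graph} → Hom G H → Set
Iso C {G} {H} f = Σ (Hom H G) λ g → C g × ((g ∘H f) ≈H idH G) × ((f ∘H g) ≈H idH H)

Balanced : MorClass → Set₁
Balanced C = ∀ {G H : Graph} (f : Hom G H) → C f → Mono C f → Epi C f → Iso C f

-- A monomorphism is injective on parts: probing it with morphisms out of a
-- single vertex, a single edge and (in Grphs) a single loop shows that it
-- identifies neither two vertices, nor two edges, nor a vertex with an edge
-- (in StGrphs strictness alone keeps vertices and edges apart).
-- An epimorphism is surjective on parts: the two inclusions of H into its
-- cokernel pair agree after f, and they agree exactly on the image of f.
-- A morphism bijective on parts has an inverse that is again a (strict)
-- graph morphism.
module Submission where

open import Level using (0ℓ)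
open import Data.Bool using (Bool; true; false)
open import Data.Empty using (⊥; ⊥-elim)
open import Data.Product using (Σ; _×_; _,_; proj₁; proj₂)
open import Data.Sum using (_⊎_; inj₁; inj₂)
open import Data.Sum.Relation.Binary.Pointwise using (inj₁; inj₂; ⊎-setoid)
open import Data.Unit using (⊤; tt)
open import Function.Definitions using (Injective; StrictlySurjective)
open import Relation.Binary.Bundles using (Setoid)
open import Relation.Nullary using (¬_)
open import Relation.Binary.PropositionalEquality as ≡ using (_≡_)

open import Defs

module UEqProperties (S : Setoid 0ℓ 0ℓ) where
  open Setoid S

  UEq-sym : ∀ {a b c d} → UEq _≈_ (a , b) (c , d) → UEq _≈_ (c , d) (a , b)
  UEq-sym (inj₁ (a≈c , b≈d)) = inj₁ (sym a≈c , sym b≈d)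
  UEq-sym (inj₂ (a≈d , b≈c)) = inj₂ (sym b≈c , sym a≈d)

  UEq-trans : ∀ {a b c d e f} → UEq _≈_ (a , b) (c , d) → UEq _≈_ (c , d) (e , f)
              → UEq _≈_ (a , b) (e , f)
  UEq-trans (inj₁ (x , y)) (inj₁ (z , w)) = inj₁ (trans x z , trans y w)
  UEq-trans (inj₁ (x , y)) (inj₂ (z , w)) = inj₂ (trans x z , trans y w)
  UEq-trans (inj₂ (x , y)) (inj₁ (z , w)) = inj₂ (trans x w , trans y z)
  UEq-trans (inj₂ (x , y)) (inj₂ (z , w)) = inj₁ (trans x w , trans y z)

UEq-diagonal : {A : Set} {R : A → A → Set} {a b c : A} → UEq R (a , b) (c , c) → R a c × R b c
UEq-diagonal (inj₁ a≈c×b≈c) = a≈c×b≈c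
UEq-diagonal (inj₂ a≈c×b≈c) = a≈c×b≈c

PartSetoid : Graph → Setoid 0ℓ 0ℓ
PartSetoid G = ⊎-setoid (V G) (E G)

UEq-inj₁ : (G : Graph) → ∀ {a b c d} → UEq (Setoid._≈_ (V G)) (a , b) (c , d)
           → UEq (_≈P_ G) (inj₁ a , inj₁ b) (inj₁ c , inj₁ d)
UEq-inj₁ G (inj₁ (a≈c , b≈d)) = inj₁ (inj₁ a≈c , inj₁ b≈d)
UEq-inj₁ G (inj₂ (a≈d , b≈c)) = inj₂ (inj₁ a≈d , inj₁ b≈c)

ψP-cong : (G : Graph) → ∀ {p q} → _≈P_ G p q → UEq (_≈P_ G) (ψP G p) (ψP G q)
ψP-cong G (inj₁ u≈v) = inj₁ (inj₁ u≈v , inj₁ u≈v)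
ψP-cong G (inj₂ a≈b) = UEq-inj₁ G (ψ-cong G a≈b)

vertex≉edge : {H : Graph} {p q : Part H} → IsVertex p → IsEdge q → ¬ _≈P_ H p q
vertex≉edge {p = inj₁ _} {inj₁ _} _ () _
vertex≉edge {p = inj₁ _} {inj₂ _} _ _ ()

module _ {G H : Graph} (f : Hom G H) where
  open UEqProperties (PartSetoid H)

  incid-along : ∀ {p q} → _≈P_ H (fun f p) q
                → UEq (_≈P_ H) (fun f (proj₁ (ψP G p)) , fun f (proj₂ (ψP G p))) (ψP H q)
  incid-along {p} fp≈q = UEq-trans (UEq-sym (incid f p)) (ψP-cong H fp≈q)

Point : Graph
Point = record { V = ≡.setoid ⊤ ; E = ≡.setoid ⊥ ; ψ = λ () ; ψ-cong = λ { {()} } }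

Segment : Graph
Segment = record { V = ≡.setoid Bool ; E = ≡.setoid ⊤ ; ψ = λ _ → true , false
                 ; ψ-cong = λ _ → inj₁ (≡.refl , ≡.refl) }

Loop : Graph
Loop = record { V = ≡.setoid ⊤ ; E = ≡.setoid ⊤ ; ψ = λ _ → tt , tt
              ; ψ-cong = λ _ → inj₁ (≡.refl , ≡.refl) }

module _ (G : Graph) where
  private
    module VG = Setoid (V G)
    module EG = Setoid (E G)
    module PG = Setoid (PartSetoid G)

  vertexAt : VG.Carrier → Hom Point G
  vertexAt u = record
    { fun = λ { (inj₁ _) → inj₁ u ; (inj₂ ()) }
    ; cong = λ { (inj₁ ≡.refl) → PG.refl ; (inj₂ {()} _) }
    ; vert = λ _ → tt
    ; incid = λ { (inj₁ _) → inj₁ (PG.refl , PG.refl) ; (inj₂ ()) } }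

  vertexAt-strict : ∀ u → IsStrict (vertexAt u)
  vertexAt-strict u ()

  edgeAt : (a : EG.Carrier) (s t : VG.Carrier) → UEq VG._≈_ (ψ G a) (s , t) → Hom Segment G
  edgeAt a s t ψa≈st = record
    { fun = map
    ; cong = λ { (inj₁ ≡.refl) → PG.refl ; (inj₂ ≡.refl) → PG.refl }
    ; vert = λ { true → tt ; false → tt }
    ; incid = incid′ }
    where
    map : Part Segment → Part G
    map (inj₁ true) = inj₁ s
    map (inj₁ false) = inj₁ t
    map (inj₂ _) = inj₂ a
    incid′ : ∀ p → UEq (_≈P_ G) (ψP G (map p))
                       (map (proj₁ (ψP Segment p)) , map (proj₂ (ψP Segment p)))
    incid′ (inj₁ true) = inj₁ (PG.refl , PG.refl)
    incid′ (inj₁ false) = inj₁ (PG.refl , PG.refl)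
    incid′ (inj₂ _) = UEq-inj₁ G ψa≈st

  edgeAt-strict : ∀ a s t ψa≈st → IsStrict (edgeAt a s t ψa≈st)
  edgeAt-strict _ _ _ _ _ = tt

  loopAt : (u : VG.Carrier) (a : EG.Carrier) → UEq VG._≈_ (ψ G a) (u , u) → Hom Loop G
  loopAt u a ψa≈uu = record
    { fun = λ { (inj₁ _) → inj₁ u ; (inj₂ _) → inj₂ a }
    ; cong = λ { (inj₁ ≡.refl) → PG.refl ; (inj₂ ≡.refl) → PG.refl }
    ; vert = λ _ → tt
    ; incid = λ { (inj₁ _) → inj₁ (PG.refl , PG.refl) ; (inj₂ _) → UEq-inj₁ G ψa≈uu } }

  collapseTo : VG.Carrier → Hom Loop G
  collapseTo u = record
    { fun = λ _ → inj₁ u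
    ; cong = λ _ → PG.refl
    ; vert = λ _ → tt
    ; incid = λ _ → inj₁ (PG.refl , PG.refl) }

module _ (C : MorClass) {G H : Graph} (f : Hom G H) (mono : Mono C f) where
  private
    module VG = Setoid (V G)
    module PH = Setoid (PartSetoid H)
  open UEqProperties (PartSetoid H)

  mono-injective-on-vertices : (∀ u → C (vertexAt G u))
                               → ∀ {u v} → _≈P_ H (fun f (inj₁ u)) (fun f (inj₁ v)) → u VG.≈ v
  mono-injective-on-vertices C-vertexAt {u} {v} fu≈fv
    with mono Point (vertexAt G u) (vertexAt G v) (C-vertexAt u) (C-vertexAt v)
              (λ { (inj₁ tt) → fu≈fv ; (inj₂ ()) }) (inj₁ tt)
  ... | inj₁ u≈v = u≈v

  mono-injective-on-edges : (∀ a s t ψa≈st → C (edgeAt G a s t ψa≈st))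
                            → ∀ {a b} → _≈P_ H (fun f (inj₂ a)) (fun f (inj₂ b)) → _≈P_ G (inj₂ a) (inj₂ b)
  mono-injective-on-edges C-edgeAt {a} {b} fa≈fb =
    matchEnds (UEq-trans (incid-along f fa≈fb) (incid f (inj₂ b)))
    where
    compareAlong : ∀ {s t} → UEq VG._≈_ (ψ G b) (s , t)
           → _≈P_ H (fun f (inj₁ (proj₁ (ψ G a)))) (fun f (inj₁ s))
           → _≈P_ H (fun f (inj₁ (proj₂ (ψ G a)))) (fun f (inj₁ t))
           → _≈P_ G (inj₂ a) (inj₂ b)
    compareAlong ψb≈st fa₁≈fs fa₂≈ft =
      mono Segment (edgeAt G a _ _ (inj₁ (VG.refl , VG.refl))) (edgeAt G b _ _ ψb≈st)
           (C-edgeAt _ _ _ _) (C-edgeAt _ _ _ _)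
           (λ { (inj₁ true) → fa₁≈fs ; (inj₁ false) → fa₂≈ft ; (inj₂ tt) → fa≈fb }) (inj₂ tt)
    matchEnds : UEq (_≈P_ H) (fun f (inj₁ (proj₁ (ψ G a))) , fun f (inj₁ (proj₂ (ψ G a))))
                         (fun f (inj₁ (proj₁ (ψ G b))) , fun f (inj₁ (proj₂ (ψ G b))))
            → _≈P_ G (inj₂ a) (inj₂ b)
    matchEnds (inj₁ (x , y)) = compareAlong (inj₁ (VG.refl , VG.refl)) x y
    matchEnds (inj₂ (x , y)) = compareAlong (inj₂ (VG.refl , VG.refl)) x y

  mono-injective : (∀ u → C (vertexAt G u)) → (∀ a s t ψa≈st → C (edgeAt G a s t ψa≈st))
                   → (∀ {u a} → ¬ _≈P_ H (fun f (inj₁ u)) (fun f (inj₂ a)))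
                   → Injective (_≈P_ G) (_≈P_ H) (fun f)
  mono-injective C-vertexAt C-edgeAt separates = injective
    where
    injective : Injective (_≈P_ G) (_≈P_ H) (fun f)
    injective {inj₁ u} {inj₁ v} fu≈fv = inj₁ (mono-injective-on-vertices C-vertexAt fu≈fv)
    injective {inj₂ a} {inj₂ b} fa≈fb = mono-injective-on-edges C-edgeAt fa≈fb
    injective {inj₁ u} {inj₂ a} fu≈fa = ⊥-elim (separates fu≈fa)
    injective {inj₂ a} {inj₁ u} fa≈fu = ⊥-elim (separates (PH.sym fa≈fu))

-- An edge identified with the vertex u is forced to be a loop at u, which
-- the monomorphism cannot tell apart from the loop collapsed onto u.
mono-separates : {G H : Graph} (f : Hom G H) → Mono AllMor f
                 → ∀ {u a} → ¬ _≈P_ H (fun f (inj₁ u)) (fun f (inj₂ a))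
mono-separates {G} {H} f mono {u} {a} fu≈fa = vertex≉edge {G} tt tt (PG.sym a≈u)
  where
  module VG = Setoid (V G)
  module PG = Setoid (PartSetoid G)
  module PH = Setoid (PartSetoid H)
  open UEqProperties (PartSetoid H)

  ends↦fu : _≈P_ H (fun f (inj₁ (proj₁ (ψ G a)))) (fun f (inj₁ u))
          × _≈P_ H (fun f (inj₁ (proj₂ (ψ G a)))) (fun f (inj₁ u))
  ends↦fu = UEq-diagonal {R = _≈P_ H} (UEq-trans (incid-along f (PH.sym fu≈fa)) (incid f (inj₁ u)))

  ψa≈uu : UEq VG._≈_ (ψ G a) (u , u)
  ψa≈uu = inj₁ ( mono-injective-on-vertices AllMor f mono (λ _ → tt) (proj₁ ends↦fu)
               , mono-injective-on-vertices AllMor f mono (λ _ → tt) (proj₂ ends↦fu))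

  a≈u : _≈P_ G (inj₂ a) (inj₁ u)
  a≈u = mono Loop (loopAt G u a ψa≈uu) (collapseTo G u) tt tt
             (λ { (inj₁ tt) → PH.refl ; (inj₂ tt) → PH.sym fu≈fa }) (inj₂ tt)

strict-separates : {G H : Graph} (f : Hom G H) → IsStrict f
                   → ∀ {u a} → ¬ _≈P_ H (fun f (inj₁ u)) (fun f (inj₂ a))
strict-separates {H = H} f strict {u} {a} = vertex≉edge {H} (vert f u) (strict a)

doubleAlong : (S : Setoid 0ℓ 0ℓ) (Q : Setoid.Carrier S → Set)
              → (∀ {x y} → Setoid._≈_ S x y → Q x → Q y) → Setoid 0ℓ 0ℓ
doubleAlong S Q Q-resp = record
  { Carrier = Bool × S.Carrier
  ; _≈_ = _≈₂_
  ; isEquivalence = record { refl = refl₂ ; sym = sym₂ ; trans = trans₂ } }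
  where
  module S = Setoid S
  _≈₂_ : Bool × S.Carrier → Bool × S.Carrier → Set
  (b , x) ≈₂ (b′ , x′) = x S.≈ x′ × (b ≡ b′ ⊎ Q x)
  refl₂ : ∀ {p} → p ≈₂ p
  refl₂ = S.refl , inj₁ ≡.refl
  sym₂ : ∀ {p q} → p ≈₂ q → q ≈₂ p
  sym₂ (x≈y , inj₁ b≡b′) = S.sym x≈y , inj₁ (≡.sym b≡b′)
  sym₂ (x≈y , inj₂ Qx) = S.sym x≈y , inj₂ (Q-resp x≈y Qx)
  trans₂ : ∀ {p q r} → p ≈₂ q → q ≈₂ r → p ≈₂ r
  trans₂ (x≈y , inj₁ b≡b′) (y≈z , inj₁ b′≡b″) = S.trans x≈y y≈z , inj₁ (≡.trans b≡b′ b′≡b″)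
  trans₂ (x≈y , inj₂ Qx) (y≈z , _) = S.trans x≈y y≈z , inj₂ Qx
  trans₂ (x≈y , inj₁ _) (y≈z , inj₂ Qy) = S.trans x≈y y≈z , inj₂ (Q-resp (S.sym x≈y) Qy)

-- The cokernel pair of f: two copies of H glued along the image of f.
module CokernelPair {G H : Graph} (f : Hom G H) where
  private
    module VH = Setoid (V H)
    module EH = Setoid (E H)
    module PH = Setoid (PartSetoid H)

  InImage : Part H → Set
  InImage p = Σ (Part G) λ a → _≈P_ H (fun f a) p

  InImage-resp : ∀ {p q} → _≈P_ H p q → InImage p → InImage q
  InImage-resp p≈q (a , fa≈p) = a , PH.trans fa≈p p≈q

  KV : Setoid 0ℓ 0ℓ
  KV = doubleAlong (V H) (λ x → InImage (inj₁ x)) (λ x≈y → InImage-resp (inj₁ x≈y))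

  KE : Setoid 0ℓ 0ℓ
  KE = doubleAlong (E H) (λ e → InImage (inj₂ e)) (λ e≈e′ → InImage-resp (inj₂ e≈e′))

  private
    module KV = Setoid KV
    module KE = Setoid KE

  ends-InImage : ∀ e → InImage (inj₂ e)
                 → InImage (inj₁ (proj₁ (ψ H e))) × InImage (inj₁ (proj₂ (ψ H e)))
  ends-InImage e (a , fa≈e) with incid-along f fa≈e
  ... | inj₁ (x , y) = (_ , x) , (_ , y)
  ... | inj₂ (x , y) = (_ , y) , (_ , x)

  Kψ : KE.Carrier → KV.Carrier × KV.Carrier
  Kψ (b , e) = (b , proj₁ (ψ H e)) , (b , proj₂ (ψ H e))

  Kψ-cong : ∀ {p q} → p KE.≈ q → UEq KV._≈_ (Kψ p) (Kψ q)
  Kψ-cong {b , e} (e≈e′ , glued) = lift (ψ-cong H e≈e′) (ends-glued glued)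
    where
    ends-glued : b ≡ _ ⊎ InImage (inj₂ e)
           → (b ≡ _ ⊎ InImage (inj₁ (proj₁ (ψ H e)))) × (b ≡ _ ⊎ InImage (inj₁ (proj₂ (ψ H e))))
    ends-glued (inj₁ b≡b′) = inj₁ b≡b′ , inj₁ b≡b′
    ends-glued (inj₂ e∈im) = inj₂ (proj₁ (ends-InImage e e∈im)) , inj₂ (proj₂ (ends-InImage e e∈im))
    lift : ∀ {b′ x y x′ y′} → UEq VH._≈_ (x , y) (x′ , y′)
           → (b ≡ b′ ⊎ InImage (inj₁ x)) × (b ≡ b′ ⊎ InImage (inj₁ y))
           → UEq KV._≈_ ((b , x) , (b , y)) ((b′ , x′) , (b′ , y′))
    lift (inj₁ (x≈x′ , y≈y′)) (gx , gy) = inj₁ ((x≈x′ , gx) , (y≈y′ , gy))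
    lift (inj₂ (x≈y′ , y≈x′)) (gx , gy) = inj₂ ((x≈y′ , gx) , (y≈x′ , gy))

  K : Graph
  K = record { V = KV ; E = KE ; ψ = Kψ ; ψ-cong = Kψ-cong }

  private
    module PK = Setoid (PartSetoid K)

  ι : Bool → Hom H K
  ι b = record
    { fun = copy
    ; cong = λ { (inj₁ x≈y) → inj₁ (x≈y , inj₁ ≡.refl) ; (inj₂ e≈e′) → inj₂ (e≈e′ , inj₁ ≡.refl) }
    ; vert = λ _ → tt
    ; incid = λ { (inj₁ _) → inj₁ (PK.refl , PK.refl) ; (inj₂ _) → inj₁ (PK.refl , PK.refl) } }
    where
    copy : Part H → Part K
    copy (inj₁ x) = inj₁ (b , x)
    copy (inj₂ e) = inj₂ (b , e)

  ι-strict : ∀ b → IsStrict (ι b)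
  ι-strict b _ = tt

  ι-agree-on-image : ∀ p → InImage p → _≈P_ K (fun (ι true) p) (fun (ι false) p)
  ι-agree-on-image (inj₁ x) x∈im = inj₁ (VH.refl , inj₂ x∈im)
  ι-agree-on-image (inj₂ e) e∈im = inj₂ (EH.refl , inj₂ e∈im)

  ι-agree⇒InImage : ∀ p → _≈P_ K (fun (ι true) p) (fun (ι false) p) → InImage p
  ι-agree⇒InImage (inj₁ x) (inj₁ (_ , inj₂ x∈im)) = x∈im
  ι-agree⇒InImage (inj₂ e) (inj₂ (_ , inj₂ e∈im)) = e∈im

  epi-surjective : (C : MorClass) → C (ι true) → C (ι false) → Epi C f
                   → StrictlySurjective (_≈P_ H) (fun f)
  epi-surjective C C-ι₁ C-ι₂ epi p =
    ι-agree⇒InImage p (epi K (ι true) (ι false) C-ι₁ C-ι₂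
                         (λ a → ι-agree-on-image (fun f a) (a , PH.refl)) p)

module Inverse {G H : Graph} (f : Hom G H)
  (injective : Injective (_≈P_ G) (_≈P_ H) (fun f))
  (surjective : StrictlySurjective (_≈P_ H) (fun f)) where
  private
    module PH = Setoid (PartSetoid H)
  open UEqProperties (PartSetoid H)

  f⁻¹ : Part H → Part G
  f⁻¹ p = proj₁ (surjective p)

  f∘f⁻¹≈id : ∀ p → _≈P_ H (fun f (f⁻¹ p)) p
  f∘f⁻¹≈id p = proj₂ (surjective p)

  UEq-injective : ∀ {a b c d} → UEq (_≈P_ H) (fun f a , fun f b) (fun f c , fun f d)
                  → UEq (_≈P_ G) (a , b) (c , d)
  UEq-injective (inj₁ (fa≈fc , fb≈fd)) = inj₁ (injective fa≈fc , injective fb≈fd)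
  UEq-injective (inj₂ (fa≈fd , fb≈fc)) = inj₂ (injective fa≈fd , injective fb≈fc)

  -- f(e) ≈ v forces f(x) ≈ v ≈ f(e) for an endpoint x of e, contradicting injectivity.
  edge↦vertex-absurd : ∀ {e v} → ¬ _≈P_ H (fun f (inj₂ e)) (inj₁ v)
  edge↦vertex-absurd {e} fe≈v with incid-along f fe≈v
  ... | inj₁ (fx≈v , _) = vertex≉edge {G} tt tt (injective (PH.trans fx≈v (PH.sym fe≈v)))
  ... | inj₂ (fx≈v , _) = vertex≉edge {G} tt tt (injective (PH.trans fx≈v (PH.sym fe≈v)))

  f⁻¹-vert : ∀ v → IsVertex (f⁻¹ (inj₁ v))
  f⁻¹-vert v = preimage-vertex (f⁻¹ (inj₁ v)) (f∘f⁻¹≈id (inj₁ v))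
    where
    preimage-vertex : ∀ a → _≈P_ H (fun f a) (inj₁ v) → IsVertex a
    preimage-vertex (inj₁ _) _ = tt
    preimage-vertex (inj₂ _) fe≈v = ⊥-elim (edge↦vertex-absurd fe≈v)

  inverse : Hom H G
  inverse = record
    { fun = f⁻¹
    ; cong = λ {p} {q} p≈q → injective (PH.trans (f∘f⁻¹≈id p) (PH.trans p≈q (PH.sym (f∘f⁻¹≈id q))))
    ; vert = f⁻¹-vert
    ; incid = λ p → UEq-injective
        (UEq-trans (incid-along f (f∘f⁻¹≈id p))
                   (UEq-sym (inj₁ (f∘f⁻¹≈id (proj₁ (ψP H p)) , f∘f⁻¹≈id (proj₂ (ψP H p)))))) }

  inverse-strict : IsStrict f → IsStrict inverse
  inverse-strict strict e = preimage-edge (f⁻¹ (inj₂ e)) (f∘f⁻¹≈id (inj₂ e))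
    where
    preimage-edge : ∀ a → _≈P_ H (fun f a) (inj₂ e) → IsEdge a
    preimage-edge (inj₂ _) _ = tt
    preimage-edge (inj₁ u) fu≈e = ⊥-elim (vertex≉edge {H} (vert f u) tt fu≈e)

  inverse-iso : (C : MorClass) → C inverse → Iso C f
  inverse-iso C C-inverse = inverse , C-inverse , (λ p → injective (f∘f⁻¹≈id (fun f p))) , f∘f⁻¹≈id

balanced-Grphs : Balanced AllMor
balanced-Grphs f _ mono epi = inverse-iso AllMor tt
  where
  open Inverse f
    (mono-injective AllMor f mono (λ _ → tt) (λ _ _ _ _ → tt) (mono-separates f mono))
    (CokernelPair.epi-surjective f AllMor tt tt epi)

balanced-StGrphs : Balanced StrictMor
balanced-StGrphs {G} f strict mono epi = inverse-iso StrictMor (inverse-strict strict)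
  where
  open CokernelPair f using (ι-strict; epi-surjective)
  open Inverse f
    (mono-injective StrictMor f mono (vertexAt-strict G) (edgeAt-strict G)
                    (strict-separates f strict))
    (epi-surjective StrictMor (ι-strict true) (ι-strict false) epi)

mainTheorem2 : Balanced AllMor × Balanced StrictMor
mainTheorem2 = balanced-Grphs , balanced-StGrphs
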